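{- Let $G$ be a connected simple graph and let $u,v\in V(G)$ with $uv\notin E(G)$. Then $\xi^{ce}(G)<\xi^{ce}(G+uv)$.
   Context: For a connected graph $G$, $d(x)$ is the degree of $x$, and the eccentricity $\varepsilon(x)$ is the maximum shortest-path distance from $x$ to any other vertex. The connective eccentricity index is $\xi^{ce}(G)=\sum_{x\in V(G)}\frac{d(x)}{\varepsilon(x)}$. $G+uv$ is the graph obtained from $G$ by adding the edge $uv$. -}

module Defs where

open import Data.Nat using (ℕ; zero; suc; _⊔_)
open import Data.Fin using (Fin; _≟_)
open import Data.Fin.Base using ()
open import Data.List using (List; allFin; map; foldr; filter; length)
open import Data.Bool using (Bool; true; false; _∨_; _∧_; T; if_then_else_)
open import Data.Integer using (+_)
open import Data.Rational using (ℚ; 0ℚ; _/_; _+_)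
open import Data.Product using (∃; _×_)
open import Relation.Nullary.Decidable using (⌊_⌋)
open import Relation.Binary.PropositionalEquality using (_≡_)

record Graph (n : ℕ) : Set where
  constructor mkGraph
  field
    adj   : Fin n → Fin n → Bool
open Graph public

IsSimple : ∀ {n} → Graph n → Set
IsSimple {n} G = (∀ (x y : Fin n) → adj G x y ≡ adj G y x) × (∀ (x : Fin n) → adj G x x ≡ false)

data Walk {n : ℕ} (adj : Fin n → Fin n → Bool) : ℕ → Fin n → Fin n → Set where
  nil  : ∀ {x} → Walk adj zero x x
  cons : ∀ {k x y z} → T (adj x y) → Walk adj k y z → Walk adj (suc k) x z

Connected : ∀ {n} → Graph n → Set
Connected G = ∀ x y → ∃ λ k → Walk (adj G) k x y

degree : ∀ {n} → Graph n → Fin n → ℕ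
degree {n} G x = length (filter (λ y → T? (adj G x y)) (allFin n))
  where
  open import Relation.Nullary.Decidable using (Dec)
  open import Data.Bool.Properties using (T?)

anyV : ∀ {n} → (Fin n → Bool) → Bool
anyV {n} p = foldr (λ y b → p y ∨ b) false (allFin n)

-- reach k x y = true iff there is a walk of length at most k from x to y
reach : ∀ {n} → Graph n → ℕ → Fin n → Fin n → Bool
reach G zero    x y = ⌊ x ≟ y ⌋
reach G (suc k) x y = reach G k x y ∨ anyV (λ z → reach G k x z ∧ adj G z y)

distFrom : ∀ {n} → Graph n → Fin n → Fin n → ℕ → ℕ → ℕ
distFrom G x y i zero       = i
distFrom G x y i (suc fuel) = if reach G i x y then i else distFrom G x y (suc i) fuel

-- shortest-path distance d(x,y) (for connected G, some walk of length < n exists)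
dist : ∀ {n} → Graph n → Fin n → Fin n → ℕ
dist {n} G x y = distFrom G x y 0 n

ecc : ∀ {n} → Graph n → Fin n → ℕ
ecc {n} G x = foldr (λ y m → dist G x y ⊔ m) 0 (allFin n)

-- d / e as a rational; convention d/0 = 0 (never used for connected graphs with ≥ 2 vertices)
frac : ℕ → ℕ → ℚ
frac d zero    = 0ℚ
frac d (suc e) = (+ d) / suc e

ξce : ∀ {n} → Graph n → ℚ
ξce {n} G = foldr (λ x q → frac (degree G x) (ecc G x) + q) 0ℚ (allFin n)

addEdge : ∀ {n} → Graph n → Fin n → Fin n → Graph n
addEdge {n} G u v = mkGraph adj'
  where
  adj' : Fin n → Fin n → Bool
  adj' x y = adj G x y ∨ (⌊ x ≟ u ⌋ ∧ ⌊ y ≟ v ⌋) ∨ (⌊ x ≟ v ⌋ ∧ ⌊ y ≟ u ⌋)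

module Submission where

-- The argument is the paper's: if H is a spanning supergraph of G (every edge
-- of G is an edge of H), then distances in H are at most those in G, hence
-- ε_H(x) ≤ ε_G(x), while d_H(x) ≥ d_G(x); so every summand d(x)/ε(x) of ξ^ce
-- weakly increases.  For H = G + uv the degree of u grows strictly, so the
-- summand at u increases strictly, and with it the whole sum.

open import Defs
open import Data.Nat using (ℕ)
open import Data.Fin using (Fin)
open import Data.Bool using (false)
open import Data.Rational using (_<_)
open import Relation.Nullary using (¬_)
open import Relation.Binary.PropositionalEquality using (_≡_)

open import Data.Nat as N using (zero; suc; _⊔_; z≤n; s≤s)
import Data.Nat.Properties as NP
open import Data.Fin using (_≟_)
open import Data.Bool using (Bool; true; _∨_; _∧_)
open import Data.Bool.Properties using (∨-zeroʳ)
open import Data.List using (List; []; _∷_; allFin; foldr; filter; length)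
open import Data.List.Relation.Unary.Any using (Any; here; there)
import Data.List.Relation.Unary.Any as Any
open import Data.List.Membership.Propositional using (_∈_)
open import Data.List.Membership.Propositional.Properties using (∈-allFin)
open import Data.Product using (_×_; _,_)
open import Data.Empty using (⊥-elim)
open import Data.Integer as Z using (+_; +≤+; +<+)
import Data.Integer.Properties as ZP
open import Data.Rational using (ℚ; 0ℚ; _+_; _≤_; toℚᵘ)
import Data.Rational.Properties as QP
open import Data.Rational.Unnormalised as U using (mkℚᵘ; *≤*; *<*)
import Data.Rational.Unnormalised.Properties as UP
open import Relation.Nullary.Decidable using (⌊_⌋; yes; no; isYes≗does; dec-true)
open import Relation.Nullary.Decidable.Core using (T?)
open import Relation.Binary.PropositionalEquality using (refl; sym; trans; subst₂)

_⇒b_ : Bool → Bool → Set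
a ⇒b b = a ≡ true → b ≡ true

∨-mono : ∀ a a' b b' → a ⇒b a' → b ⇒b b' → (a ∨ b) ⇒b (a' ∨ b')
∨-mono true  a' b b' a⇒a' b⇒b' _  rewrite a⇒a' refl = refl
∨-mono false a' b b' a⇒a' b⇒b' b≡ rewrite b⇒b' b≡  = ∨-zeroʳ a'

∧-mono : ∀ a a' b b' → a ⇒b a' → b ⇒b b' → (a ∧ b) ⇒b (a' ∧ b')
∧-mono true  a' true  b' a⇒a' b⇒b' _ rewrite a⇒a' refl | b⇒b' refl = refl
∧-mono true  a' false b' a⇒a' b⇒b' ()
∧-mono false a' b     b' a⇒a' b⇒b' ()

any-mono : ∀ {A : Set} (p q : A → Bool) → (∀ z → p z ⇒b q z) → (xs : List A) →
  foldr (λ y b → p y ∨ b) false xs ⇒b foldr (λ y b → q y ∨ b) false xs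
any-mono p q p⇒q []       ()
any-mono p q p⇒q (x ∷ xs) = ∨-mono (p x) (q x) _ _ (p⇒q x) (any-mono p q p⇒q xs)

_⊆_ : ∀ {n} → Graph n → Graph n → Set
G ⊆ H = ∀ x y → adj G x y ⇒b adj H x y

⊆-addEdge : ∀ {n} (G : Graph n) (u v : Fin n) → G ⊆ addEdge G u v
⊆-addEdge G u v x y adj≡ rewrite adj≡ = refl

reach-mono : ∀ {n} {G H : Graph n} → G ⊆ H → ∀ k x y → reach G k x y ⇒b reach H k x y
reach-mono G⊆H zero    x y r = r
reach-mono {n} G⊆H (suc k) x y = ∨-mono _ _ _ _ (reach-mono G⊆H k x y)
  (any-mono _ _ (λ z → ∧-mono _ _ _ _ (reach-mono G⊆H k x z) (G⊆H z y)) (allFin n))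

distFrom-≥ : ∀ {n} (G : Graph n) x y i fuel → i N.≤ distFrom G x y i fuel
distFrom-≥ G x y i zero = NP.≤-refl
distFrom-≥ G x y i (suc fuel) with reach G i x y
... | true  = NP.≤-refl
... | false = NP.≤-trans (NP.n≤1+n i) (distFrom-≥ G x y (suc i) fuel)

distFrom-antitone : ∀ {n} {G H : Graph n} → G ⊆ H →
  ∀ x y i fuel → distFrom H x y i fuel N.≤ distFrom G x y i fuel
distFrom-antitone G⊆H x y i zero = NP.≤-refl
distFrom-antitone {G = G} {H} G⊆H x y i (suc fuel)
  with reach G i x y in reachG | reach H i x y in reachH
... | true  | true  = NP.≤-refl
... | true  | false with () ← trans (sym (reach-mono G⊆H i x y reachG)) reachH
... | false | true  = NP.≤-trans (NP.n≤1+n i) (distFrom-≥ G x y (suc i) fuel)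
... | false | false = distFrom-antitone G⊆H x y (suc i) fuel

dist-antitone : ∀ {n} {G H : Graph n} → G ⊆ H → ∀ x y → dist H x y N.≤ dist G x y
dist-antitone {n} G⊆H x y = distFrom-antitone G⊆H x y 0 n

maxOver : ∀ {A : Set} → (A → ℕ) → List A → ℕ
maxOver h xs = foldr (λ y m → h y ⊔ m) 0 xs

maxOver-mono : ∀ {A : Set} (h k : A → ℕ) → (∀ y → h y N.≤ k y) →
  ∀ xs → maxOver h xs N.≤ maxOver k xs
maxOver-mono h k h≤k []       = z≤n
maxOver-mono h k h≤k (x ∷ xs) = NP.⊔-mono-≤ (h≤k x) (maxOver-mono h k h≤k xs)

maxOver-≥ : ∀ {A : Set} (h : A → ℕ) {y} xs → y ∈ xs → h y N.≤ maxOver h xs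
maxOver-≥ h (x ∷ xs) (here refl) = NP.m≤m⊔n (h x) _
maxOver-≥ h (x ∷ xs) (there y∈xs) = NP.≤-trans (maxOver-≥ h xs y∈xs) (NP.m≤n⊔m (h x) _)

ecc-antitone : ∀ {n} {G H : Graph n} → G ⊆ H → ∀ x → ecc H x N.≤ ecc G x
ecc-antitone {n} {G} {H} G⊆H x =
  maxOver-mono (dist H x) (dist G x) (dist-antitone G⊆H x) (allFin n)

count : ∀ {A : Set} → (A → Bool) → List A → ℕ
count p xs = length (filter (λ y → T? (p y)) xs)

count-mono : ∀ {A : Set} (p q : A → Bool) → (∀ y → p y ⇒b q y) →
  ∀ xs → count p xs N.≤ count q xs
count-mono p q p⇒q [] = z≤n
count-mono p q p⇒q (x ∷ xs) with p x in px | q x in qx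
... | true  | true  = s≤s (count-mono p q p⇒q xs)
... | true  | false with () ← trans (sym (p⇒q x px)) qx
... | false | true  = NP.m≤n⇒m≤1+n (count-mono p q p⇒q xs)
... | false | false = count-mono p q p⇒q xs

count-strict : ∀ {A : Set} (p q : A → Bool) → (∀ y → p y ⇒b q y) → ∀ xs →
  Any (λ y → (p y ≡ false) × (q y ≡ true)) xs → count p xs N.< count q xs
count-strict p q p⇒q (x ∷ xs) (here (px , qx)) rewrite px | qx = s≤s (count-mono p q p⇒q xs)
count-strict p q p⇒q (x ∷ xs) (there witness) with p x in px | q x in qx
... | true  | true  = s≤s (count-strict p q p⇒q xs witness)
... | true  | false with () ← trans (sym (p⇒q x px)) qx
... | false | true  = NP.m≤n⇒m≤1+n (count-strict p q p⇒q xs witness)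
... | false | false = count-strict p q p⇒q xs witness

degree-mono : ∀ {n} {G H : Graph n} → G ⊆ H → ∀ x → degree G x N.≤ degree H x
degree-mono {n} {G} {H} G⊆H x = count-mono (adj G x) (adj H x) (G⊆H x) (allFin n)

degree-strict : ∀ {n} {G H : Graph n} → G ⊆ H → ∀ x y →
  adj G x y ≡ false → adj H x y ≡ true → degree G x N.< degree H x
degree-strict {n} {G} {H} G⊆H x y ¬Gxy Hxy =
  count-strict (adj G x) (adj H x) (G⊆H x) (allFin n)
    (Any.map (λ { refl → ¬Gxy , Hxy }) (∈-allFin y))

dist-pos : ∀ {n} (G : Graph n) x y → ¬ (x ≡ y) → 1 N.≤ dist G x y
dist-pos {suc m} G x y x≢y with x ≟ y
... | yes x≡y = ⊥-elim (x≢y x≡y)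
... | no  _   = distFrom-≥ G x y 1 m

ecc-pos : ∀ {n} (G : Graph n) {u v : Fin n} → ¬ (u ≡ v) → ∀ x → 1 N.≤ ecc G x
ecc-pos {n} G {u} {v} u≢v x with x ≟ u
... | yes refl = NP.≤-trans (dist-pos G x v u≢v) (maxOver-≥ (dist G x) (allFin n) (∈-allFin v))
... | no  x≢u  = NP.≤-trans (dist-pos G x u x≢u) (maxOver-≥ (dist G x) (allFin n) (∈-allFin u))

frac≃ : ∀ d e → toℚᵘ (frac d (suc e)) U.≃ mkℚᵘ (+ d) e
frac≃ d e = QP.toℚᵘ-fromℚᵘ (mkℚᵘ (+ d) e)

frac-mono : ∀ d d' E E' → d N.≤ d' → 1 N.≤ E' → E' N.≤ E → frac d E ≤ frac d' E'
frac-mono d d' (suc e) (suc e') d≤d' _ (s≤s e'≤e) = QP.toℚᵘ-cancel-≤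
  (UP.≤-respˡ-≃ (UP.≃-sym (frac≃ d e)) (UP.≤-respʳ-≃ (UP.≃-sym (frac≃ d' e')) cross))
  where
  cross : mkℚᵘ (+ d) e U.≤ mkℚᵘ (+ d') e'
  cross = *≤* (subst₂ Z._≤_ (ZP.pos-* d (suc e')) (ZP.pos-* d' (suc e))
                (+≤+ (NP.*-mono-≤ d≤d' (s≤s e'≤e))))

frac-strict : ∀ d d' E E' → d N.< d' → 1 N.≤ E' → E' N.≤ E → frac d E < frac d' E'
frac-strict d d' (suc e) (suc e') d<d' _ (s≤s e'≤e) = QP.toℚᵘ-cancel-<
  (UP.<-respˡ-≃ (UP.≃-sym (frac≃ d e)) (UP.<-respʳ-≃ (UP.≃-sym (frac≃ d' e')) cross))
  where
  -- d · (1+e') ≤ d · (1+e) < d' · (1+e)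
  cross : mkℚᵘ (+ d) e U.< mkℚᵘ (+ d') e'
  cross = *<* (subst₂ Z._<_ (ZP.pos-* d (suc e')) (ZP.pos-* d' (suc e))
                (+<+ (NP.≤-<-trans (NP.*-monoʳ-≤ d (s≤s e'≤e)) (NP.*-monoˡ-< (suc e) d<d'))))

sumOver : ∀ {A : Set} → (A → ℚ) → List A → ℚ
sumOver h xs = foldr (λ x q → h x + q) 0ℚ xs

sumOver-mono : ∀ {A : Set} (h k : A → ℚ) → (∀ x → h x ≤ k x) →
  ∀ xs → sumOver h xs ≤ sumOver k xs
sumOver-mono h k h≤k []       = QP.≤-refl
sumOver-mono h k h≤k (x ∷ xs) = QP.+-mono-≤ (h≤k x) (sumOver-mono h k h≤k xs)

sumOver-strict : ∀ {A : Set} (h k : A → ℚ) → (∀ x → h x ≤ k x) → ∀ xs →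
  Any (λ x → h x < k x) xs → sumOver h xs < sumOver k xs
sumOver-strict h k h≤k (x ∷ xs) (here hx<kx) = QP.+-mono-<-≤ hx<kx (sumOver-mono h k h≤k xs)
sumOver-strict h k h≤k (x ∷ xs) (there w)    = QP.+-mono-≤-< (h≤k x) (sumOver-strict h k h≤k xs w)

≟-refl : ∀ {n} (x : Fin n) → ⌊ x ≟ x ⌋ ≡ true
≟-refl x = trans (isYes≗does (x ≟ x)) (dec-true (x ≟ x) refl)

addEdge-adj : ∀ {n} (G : Graph n) (u v : Fin n) → adj (addEdge G u v) u v ≡ true
addEdge-adj G u v rewrite ≟-refl u | ≟-refl v = ∨-zeroʳ (adj G u v)

lemma2p5 : ∀ {n : ℕ} (G : Graph n) → IsSimple G → Connected G →
    (u v : Fin n) → ¬ (u ≡ v) → adj G u v ≡ false →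
    ξce G < ξce (addEdge G u v)
lemma2p5 {n} G _ _ u v u≢v ¬uv =
  sumOver-strict _ _ summand-mono (allFin n) (Any.map (λ { refl → summand-strict }) (∈-allFin u))
  where
  H : Graph n
  H = addEdge G u v

  G⊆H : G ⊆ H
  G⊆H = ⊆-addEdge G u v

  summand-mono : ∀ x → frac (degree G x) (ecc G x) ≤ frac (degree H x) (ecc H x)
  summand-mono x = frac-mono _ _ _ _ (degree-mono G⊆H x) (ecc-pos H u≢v x) (ecc-antitone G⊆H x)

  summand-strict : frac (degree G u) (ecc G u) < frac (degree H u) (ecc H u)
  summand-strict = frac-strict _ _ _ _ (degree-strict G⊆H u v ¬uv (addEdge-adj G u v))
                     (ecc-pos H u≢v u) (ecc-antitone G⊆H u)
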